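{- Let $f:\{0,1\}^n\to\{ -1,1\}$ depend on all of its $n$ input variables, with Fourier expansion $f=\sum_{S\subseteq[n]}\hat f(S)\chi_S$. Then $\sum_{S\subseteq[n]}|\hat f(S)|\,|S|\ge n$.
   Context: $\chi_S(x)=(-1)^{\sum_{i\in S}x_i}$ and $\hat f(S)=2^{ -n}\sum_x f(x)\chi_S(x)$. $f$ depends on variable $i$ if there is $x$ with $f(x)\ne f(x\oplus e_i)$. -}

module Defs where

open import Data.Bool using (Bool; true; false; if_then_else_; _xor_)
open import Data.Nat as ℕ using (ℕ; zero; suc; _^_)
open import Data.Integer as ℤ using (ℤ; +_; -_)
open import Data.Rational as ℚ using (ℚ; _/_)
open import Data.List using (List; []; _∷_; map; _++_; foldr)
open import Data.Vec using (Vec; []; _∷_; updateAt)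
open import Data.Fin using (Fin)
open import Relation.Binary.PropositionalEquality using (_≡_)
open import Data.Product using (∃)
open import Relation.Nullary using (¬_)

-- Points of {0,1}^n (false = 0, true = 1); subsets S ⊆ [n] are encoded
-- by their indicator vectors, also Vec Bool n.
Cube : ℕ → Set
Cube n = Vec Bool n

allCube : (n : ℕ) → List (Cube n)
allCube zero = [] ∷ []
allCube (suc n) = map (false ∷_) (allCube n) ++ map (true ∷_) (allCube n)

card : ∀ {n} → Cube n → ℕ
card [] = 0
card (false ∷ s) = card s
card (true ∷ s) = suc (card s)

parity : ∀ {n} → Cube n → Cube n → Bool
parity [] [] = false
parity (s ∷ ss) (x ∷ xs) = (if s then x else false) xor parity ss xs

χ : ∀ {n} → Cube n → Cube n → ℤ
χ S x = if parity S x then ℤ.-[1+ 0 ] else + 1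

sumℤ : List ℤ → ℤ
sumℤ = foldr ℤ._+_ (+ 0)

sumℚ : List ℚ → ℚ
sumℚ = foldr ℚ._+_ ℚ.0ℚ

IsSignValued : ∀ {n} → (Cube n → ℤ) → Set
IsSignValued {n} f = ∀ (x : Cube n) → (f x ≡ + 1) Data.Sum.⊎ (f x ≡ - (+ 1))
  where import Data.Sum

fourier : ∀ {n} → (Cube n → ℤ) → Cube n → ℚ
fourier {n} f S = sumℤ (map (λ x → f x ℤ.* χ S x) (allCube n)) / (2 ^ n)
  where instance
          nz : ℕ.NonZero (2 ^ n)
          nz = ℕ.>-nonZero (Data.Nat.Properties.m^n>0 2 n)
            where import Data.Nat.Properties

flip : ∀ {n} → Cube n → Fin n → Cube n
flip x i = updateAt x i Data.Bool.not
  where import Data.Bool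

DependsOn : ∀ {n} → (Cube n → ℤ) → Fin n → Set
DependsOn {n} f i = ∃ λ (x : Cube n) → ¬ (f x ≡ f (flip x i))

weightedL1 : ∀ {n} → (Cube n → ℤ) → ℚ
weightedL1 {n} f = sumℚ (map (λ S → ℚ.∣ fourier f S ∣ ℚ.* (ℤ.+ card S / 1)) (allCube n))

module Submission where

-- Work with the unnormalised coefficients
--   coeff h S = Σ_x h(x) χ_S(x) = 2^n ĥ(S),
-- so that, after clearing the common denominator 2^n, the claim becomes the
-- natural-number inequality  n · 2^n ≤ Σ_S |coeff f S| · |S|.
--   * Inversion bound: 2^n |h(x)| ≤ Σ_S |coeff h S| for every integer-valued h
--     (induction on n, splitting the cube along its first coordinate).
--   * Derivatives: for D_i h(x) = h(x) − h(x ⊕ e_i) one has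
--     coeff (D_i h) S = 2 · coeff h S if i ∈ S and 0 otherwise; this rests on
--     the invariance of sums over the cube under x ↦ x ⊕ e_i.
--   * If f is ±1-valued and depends on i, then |D_i f(x)| = 2 for some x, and
--     the inversion bound applied to D_i f gives 2^n ≤ Σ_{S ∋ i} |coeff f S|.
--   * Writing |S| = Σ_i [i ∈ S] and exchanging sums, Σ_S |coeff f S| · |S| is
--     the sum over i of these n quantities, hence at least n · 2^n.

open import Defs
open import Data.Nat using (ℕ)
open import Data.Fin using (Fin)
open import Data.Integer using (ℤ; +_)
open import Data.Rational using (ℚ; _≤_; _/_)

open import Algebra.Bundles using (CommutativeMonoid)
open import Algebra.Structures using (IsCommutativeMonoid)
open import Data.Bool using (Bool; true; false; not; if_then_else_; _xor_)
open import Data.Bool.Properties using (not-involutive; not-distribˡ-xor; not-distribʳ-xor)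
open import Data.Fin using (zero; suc)
open import Data.Nat using (zero; suc)
open import Data.List using (List; []; _∷_; map; _++_; foldr)
open import Data.List.Properties using (map-∘)
open import Data.Product using (_×_; _,_; proj₁; proj₂)
open import Data.Sum using (_⊎_; inj₁; inj₂)
open import Data.Vec using ([]; _∷_; lookup)
open import Data.Vec.Properties using (updateAt-updateAt-local; updateAt-id)
open import Function using (_∘_)
open import Relation.Binary.PropositionalEquality
open import Relation.Nullary using (¬_; contradiction)

import Data.Nat as ℕ
import Data.Nat.Properties as ℕP
import Data.Integer as ℤ
import Data.Integer.Properties as ℤP
import Data.Integer.Tactic.RingSolver as ℤRing
import Data.Rational as ℚ
import Data.Rational.Properties as ℚP
import Data.Rational.Unnormalised as ℚᵘ
import Data.Rational.Unnormalised.Properties as ℚᵘP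

module ListSum {a} {M : Set a} {_∙_ : M → M → M} {ε : M}
               (isCM : IsCommutativeMonoid _≡_ _∙_ ε) where

  open IsCommutativeMonoid isCM using (assoc; comm; identityˡ; identityʳ)

  commutativeMonoid : CommutativeMonoid a a
  commutativeMonoid = record { isCommutativeMonoid = isCM }

  open import Algebra.Properties.CommutativeSemigroup
    (CommutativeMonoid.commutativeSemigroup commutativeMonoid) using (interchange)
  open import Algebra.Properties.CommutativeMonoid.Sum commutativeMonoid public
    using (sum; sum-syntax)
  open import Algebra.Properties.CommutativeMonoid.Sum commutativeMonoid
    using (∑-distrib-+; sum-replicate-zero)

  ∑ : ∀ {b} {A : Set b} → (A → M) → List A → M
  ∑ f L = foldr _∙_ ε (map f L)

  ∑-cong : ∀ {b} {A : Set b} {f g : A → M} → (∀ x → f x ≡ g x) → ∀ L → ∑ f L ≡ ∑ g L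
  ∑-cong f≗g []      = refl
  ∑-cong f≗g (x ∷ L) = cong₂ _∙_ (f≗g x) (∑-cong f≗g L)

  ∑-++ : ∀ {b} {A : Set b} (f : A → M) xs ys → ∑ f (xs ++ ys) ≡ ∑ f xs ∙ ∑ f ys
  ∑-++ f []       ys = sym (identityˡ (∑ f ys))
  ∑-++ f (x ∷ xs) ys = trans (cong (f x ∙_) (∑-++ f xs ys)) (sym (assoc (f x) _ _))

  ∑-map : ∀ {b c} {A : Set b} {B : Set c} (f : B → M) (g : A → B) L → ∑ f (map g L) ≡ ∑ (f ∘ g) L
  ∑-map f g L = cong (foldr _∙_ ε) (sym (map-∘ L))

  ∑-+ : ∀ {b} {A : Set b} (f g : A → M) L → ∑ (λ x → f x ∙ g x) L ≡ ∑ f L ∙ ∑ g L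
  ∑-+ f g []      = sym (identityʳ ε)
  ∑-+ f g (x ∷ L) = trans (cong ((f x ∙ g x) ∙_) (∑-+ f g L)) (interchange (f x) (g x) (∑ f L) (∑ g L))

  ∑-hom : ∀ {b} {A : Set b} (φ : M → M) → φ ε ≡ ε → (∀ x y → φ (x ∙ y) ≡ φ x ∙ φ y) →
          ∀ (f : A → M) L → φ (∑ f L) ≡ ∑ (φ ∘ f) L
  ∑-hom φ φ0 φ+ f []      = φ0
  ∑-hom φ φ0 φ+ f (x ∷ L) = trans (φ+ (f x) (∑ f L)) (cong (φ (f x) ∙_) (∑-hom φ φ0 φ+ f L))

  ∑-swap : ∀ {b} {A : Set b} {n} (g : A → Fin n → M) L →
           ∑ (λ x → ∑[ i < n ] g x i) L ≡ ∑[ i < n ] ∑ (λ x → g x i) L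
  ∑-swap {n = n} g []      = sym (sum-replicate-zero n)
  ∑-swap         g (x ∷ L) =
    trans (cong (sum (g x) ∙_) (∑-swap g L)) (sym (∑-distrib-+ (g x) _))

  ∑-cube-split : ∀ {n} (f : Cube (suc n) → M) →
    ∑ f (allCube (suc n)) ≡ ∑ (f ∘ (false ∷_)) (allCube n) ∙ ∑ (f ∘ (true ∷_)) (allCube n)
  ∑-cube-split {n} f =
    trans (∑-++ f (map (false ∷_) (allCube n)) _)
          (cong₂ _∙_ (∑-map f _ (allCube n)) (∑-map f _ (allCube n)))

  ∑-flip : ∀ {n} (f : Cube n → M) (i : Fin n) →
           ∑ (λ x → f (flip x i)) (allCube n) ≡ ∑ f (allCube n)
  ∑-flip {suc n} f zero = begin
    ∑ (λ x → f (flip x zero)) (allCube (suc n))                    ≡⟨ ∑-cube-split {n} _ ⟩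
    ∑ (f ∘ (true ∷_)) (allCube n) ∙ ∑ (f ∘ (false ∷_)) (allCube n)  ≡⟨ comm _ _ ⟩
    ∑ (f ∘ (false ∷_)) (allCube n) ∙ ∑ (f ∘ (true ∷_)) (allCube n)  ≡⟨ sym (∑-cube-split f) ⟩
    ∑ f (allCube (suc n))                                          ∎
    where open ≡-Reasoning
  ∑-flip {suc n} f (suc i) = begin
    ∑ (λ x → f (flip x (suc i))) (allCube (suc n))  ≡⟨ ∑-cube-split {n} _ ⟩
    ∑ (λ x → f (false ∷ flip x i)) (allCube n) ∙ ∑ (λ x → f (true ∷ flip x i)) (allCube n)
      ≡⟨ cong₂ _∙_ (∑-flip (f ∘ (false ∷_)) i) (∑-flip (f ∘ (true ∷_)) i) ⟩
    ∑ (f ∘ (false ∷_)) (allCube n) ∙ ∑ (f ∘ (true ∷_)) (allCube n)  ≡⟨ sym (∑-cube-split f) ⟩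
    ∑ f (allCube (suc n))                                          ∎
    where open ≡-Reasoning

module ℤ∑ = ListSum ℤP.+-0-isCommutativeMonoid
open ListSum ℕP.+-0-isCommutativeMonoid

∑-mono-≤ : ∀ {b} {A : Set b} {f g : A → ℕ} → (∀ x → f x ℕ.≤ g x) → ∀ L → ∑ f L ℕ.≤ ∑ g L
∑-mono-≤ f≤g []      = ℕ.z≤n
∑-mono-≤ f≤g (x ∷ L) = ℕP.+-mono-≤ (f≤g x) (∑-mono-≤ f≤g L)

∑-lower-bound : ∀ n k (g : Fin n → ℕ) → (∀ i → k ℕ.≤ g i) → n ℕ.* k ℕ.≤ ∑[ i < n ] g i
∑-lower-bound zero    k g k≤g = ℕ.z≤n
∑-lower-bound (suc n) k g k≤g = ℕP.+-mono-≤ (k≤g zero) (∑-lower-bound n k (g ∘ suc) (k≤g ∘ suc))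

-- sign b = (−1)^b, so that χ S x = sign (parity S x) by definition.
sign : Bool → ℤ
sign b = if b then ℤ.- + 1 else + 1

sign-xor : ∀ a b → sign (a xor b) ≡ sign a ℤ.* sign b
sign-xor false b     = sym (ℤP.*-identityˡ (sign b))
sign-xor true  false = refl
sign-xor true  true  = refl

sign-not : ∀ b → sign (not b) ≡ ℤ.- sign b
sign-not false = refl
sign-not true  = refl

parity-flip : ∀ {n} (S x : Cube n) (i : Fin n) → parity S (flip x i) ≡ lookup S i xor parity S x
parity-flip (false ∷ S) (b ∷ x) zero    = refl
parity-flip (true  ∷ S) (b ∷ x) zero    = sym (not-distribˡ-xor b (parity S x))
parity-flip (s ∷ S)     (b ∷ x) (suc i) =
  trans (cong ((if s then b else false) xor_) (parity-flip S x i))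
        (xor-swap (if s then b else false) (lookup S i) (parity S x))
  where
  xor-swap : ∀ c l p → c xor (l xor p) ≡ l xor (c xor p)
  xor-swap false l p = refl
  xor-swap true  l p = not-distribʳ-xor l p

χ-flip : ∀ {n} (S x : Cube n) (i : Fin n) → χ S (flip x i) ≡ sign (lookup S i) ℤ.* χ S x
χ-flip S x i = trans (cong sign (parity-flip S x i)) (sign-xor (lookup S i) (parity S x))

flip-involutive : ∀ {n} (x : Cube n) (i : Fin n) → flip (flip x i) i ≡ x
flip-involutive x i = trans (updateAt-updateAt-local i x (not-involutive (lookup x i))) (updateAt-id i x)

coeff : ∀ {n} → (Cube n → ℤ) → Cube n → ℤ
coeff {n} h S = ℤ∑.∑ (λ x → h x ℤ.* χ S x) (allCube n)

restrict : ∀ {n} → Bool → (Cube (suc n) → ℤ) → Cube n → ℤ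
restrict b h x = h (b ∷ x)

coeff-split-false : ∀ {n} (h : Cube (suc n) → ℤ) S →
  coeff h (false ∷ S) ≡ coeff (restrict false h) S ℤ.+ coeff (restrict true h) S
coeff-split-false h S = ℤ∑.∑-cube-split (λ x → h x ℤ.* χ (false ∷ S) x)

coeff-split-true : ∀ {n} (h : Cube (suc n) → ℤ) S →
  coeff h (true ∷ S) ≡ coeff (restrict false h) S ℤ.- coeff (restrict true h) S
coeff-split-true {n} h S = begin
  coeff h (true ∷ S)
    ≡⟨ ℤ∑.∑-cube-split (λ x → h x ℤ.* χ (true ∷ S) x) ⟩
  coeff (restrict false h) S ℤ.+ ℤ∑.∑ (λ x → h (true ∷ x) ℤ.* sign (not (parity S x))) (allCube n)
    ≡⟨ cong (λ t → coeff (restrict false h) S ℤ.+ t) (ℤ∑.∑-cong negate (allCube n)) ⟩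
  coeff (restrict false h) S ℤ.+ ℤ∑.∑ (λ x → ℤ.- (h (true ∷ x) ℤ.* χ S x)) (allCube n)
    ≡⟨ cong (λ t → coeff (restrict false h) S ℤ.+ t) (sym (ℤ∑.∑-hom ℤ.-_ refl ℤP.neg-distrib-+ _ (allCube n))) ⟩
  coeff (restrict false h) S ℤ.- coeff (restrict true h) S ∎
  where
  open ≡-Reasoning
  negate : ∀ x → h (true ∷ x) ℤ.* sign (not (parity S x)) ≡ ℤ.- (h (true ∷ x) ℤ.* χ S x)
  negate x = trans (cong (h (true ∷ x) ℤ.*_) (sign-not (parity S x)))
                   (sym (ℤP.neg-distribʳ-* (h (true ∷ x)) (χ S x)))

coeff-sub : ∀ {n} (g h : Cube n → ℤ) S → coeff (λ x → g x ℤ.- h x) S ≡ coeff g S ℤ.- coeff h S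
coeff-sub {n} g h S = begin
  coeff (λ x → g x ℤ.- h x) S
    ≡⟨ ℤ∑.∑-cong distribute (allCube n) ⟩
  ℤ∑.∑ (λ x → g x ℤ.* χ S x ℤ.+ ℤ.- (h x ℤ.* χ S x)) (allCube n)
    ≡⟨ ℤ∑.∑-+ _ _ (allCube n) ⟩
  coeff g S ℤ.+ ℤ∑.∑ (λ x → ℤ.- (h x ℤ.* χ S x)) (allCube n)
    ≡⟨ cong (λ t → coeff g S ℤ.+ t) (sym (ℤ∑.∑-hom ℤ.-_ refl ℤP.neg-distrib-+ _ (allCube n))) ⟩
  coeff g S ℤ.- coeff h S ∎
  where
  open ≡-Reasoning
  distribute : ∀ x → (g x ℤ.- h x) ℤ.* χ S x ≡ g x ℤ.* χ S x ℤ.+ ℤ.- (h x ℤ.* χ S x)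
  distribute x = trans (ℤP.*-distribʳ-+ (χ S x) (g x) (ℤ.- h x))
                       (cong (λ t → g x ℤ.* χ S x ℤ.+ t) (sym (ℤP.neg-distribˡ-* (h x) (χ S x))))

coeff-flip : ∀ {n} (h : Cube n → ℤ) (i : Fin n) S →
  coeff (λ x → h (flip x i)) S ≡ sign (lookup S i) ℤ.* coeff h S
coeff-flip {n} h i S = begin
  ℤ∑.∑ (λ x → h (flip x i) ℤ.* χ S x) (allCube n)
    ≡⟨ ℤ∑.∑-cong (λ x → cong (λ y → h (flip x i) ℤ.* χ S y) (sym (flip-involutive x i))) (allCube n) ⟩
  ℤ∑.∑ (λ x → h (flip x i) ℤ.* χ S (flip (flip x i) i)) (allCube n)
    ≡⟨ ℤ∑.∑-flip (λ y → h y ℤ.* χ S (flip y i)) i ⟩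
  ℤ∑.∑ (λ y → h y ℤ.* χ S (flip y i)) (allCube n)
    ≡⟨ ℤ∑.∑-cong (λ y → trans (cong (h y ℤ.*_) (χ-flip S y i)) (swap (h y) (χ S y))) (allCube n) ⟩
  ℤ∑.∑ (λ y → σ ℤ.* (h y ℤ.* χ S y)) (allCube n)
    ≡⟨ sym (ℤ∑.∑-hom (σ ℤ.*_) (ℤP.*-zeroʳ σ) (ℤP.*-distribˡ-+ σ) _ (allCube n)) ⟩
  σ ℤ.* coeff h S ∎
  where
  open ≡-Reasoning
  σ = sign (lookup S i)
  swap : ∀ u c → u ℤ.* (σ ℤ.* c) ≡ σ ℤ.* (u ℤ.* c)
  swap u c = trans (sym (ℤP.*-assoc u σ c))
                   (trans (cong (ℤ._* c) (ℤP.*-comm u σ)) (ℤP.*-assoc σ u c))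

derivative : ∀ {n} → Fin n → (Cube n → ℤ) → Cube n → ℤ
derivative i h x = h x ℤ.- h (flip x i)

coeff-derivative : ∀ {n} (h : Cube n → ℤ) (i : Fin n) S →
  coeff (derivative i h) S ≡ coeff h S ℤ.- sign (lookup S i) ℤ.* coeff h S
coeff-derivative h i S =
  trans (coeff-sub h (λ x → h (flip x i)) S) (cong (λ t → coeff h S ℤ.- t) (coeff-flip h i S))

∣c-signc∣ : ∀ b c → ℤ.∣ c ℤ.- sign b ℤ.* c ∣ ≡ 2 ℕ.* (if b then ℤ.∣ c ∣ else 0)
∣c-signc∣ false c = cong ℤ.∣_∣ (trans (cong (λ t → c ℤ.- t) (ℤP.*-identityˡ c)) (ℤP.+-inverseʳ c))
∣c-signc∣ true  c = trans (cong ℤ.∣_∣ (doubling c)) (ℤP.∣i*j∣≡∣i∣*∣j∣ (+ 2) c)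
  where
  doubling : ∀ c → c ℤ.- (ℤ.- + 1) ℤ.* c ≡ + 2 ℤ.* c
  doubling = ℤRing.solve-∀

spectralNorm : ∀ {n} → (Cube n → ℤ) → ℕ
spectralNorm {n} h = ∑ (λ S → ℤ.∣ coeff h S ∣) (allCube n)

spectralWeight : ∀ {n} → Fin n → (Cube n → ℤ) → ℕ
spectralWeight {n} i h = ∑ (λ S → if lookup S i then ℤ.∣ coeff h S ∣ else 0) (allCube n)

spectralNorm-derivative : ∀ {n} (h : Cube n → ℤ) (i : Fin n) →
  spectralNorm (derivative i h) ≡ 2 ℕ.* spectralWeight i h
spectralNorm-derivative {n} h i =
  trans (∑-cong (λ S → trans (cong ℤ.∣_∣ (coeff-derivative h i S)) (∣c-signc∣ (lookup S i) (coeff h S)))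
                (allCube n))
        (sym (∑-hom (2 ℕ.*_) refl (ℕP.*-distribˡ-+ 2) _ (allCube n)))

sum-difference-bound : ∀ u v →
  2 ℕ.* ℤ.∣ u ∣ ℕ.≤ ℤ.∣ u ℤ.+ v ∣ ℕ.+ ℤ.∣ u ℤ.- v ∣ × 2 ℕ.* ℤ.∣ v ∣ ℕ.≤ ℤ.∣ u ℤ.+ v ∣ ℕ.+ ℤ.∣ u ℤ.- v ∣
sum-difference-bound u v =
  bound u (sum-plus-difference u v) (ℤP.∣i+j∣≤∣i∣+∣j∣ (u ℤ.+ v) (u ℤ.- v)) ,
  bound v (sum-minus-difference u v) (ℤP.∣i-j∣≤∣i∣+∣j∣ (u ℤ.+ v) (u ℤ.- v))
  where
  sum-plus-difference : ∀ u v → (u ℤ.+ v) ℤ.+ (u ℤ.- v) ≡ + 2 ℤ.* u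
  sum-plus-difference = ℤRing.solve-∀
  sum-minus-difference : ∀ u v → (u ℤ.+ v) ℤ.- (u ℤ.- v) ≡ + 2 ℤ.* v
  sum-minus-difference = ℤRing.solve-∀
  bound : ∀ w {t m} → t ≡ + 2 ℤ.* w → ℤ.∣ t ∣ ℕ.≤ m → 2 ℕ.* ℤ.∣ w ∣ ℕ.≤ m
  bound w {t} t≡2w ∣t∣≤m = subst (ℕ._≤ _) (trans (cong ℤ.∣_∣ t≡2w) (ℤP.∣i*j∣≡∣i∣*∣j∣ (+ 2) w)) ∣t∣≤m

halves-bound : ∀ {n} (h : Cube (suc n) → ℤ) b S →
  2 ℕ.* ℤ.∣ coeff (restrict b h) S ∣ ℕ.≤ ℤ.∣ coeff h (false ∷ S) ∣ ℕ.+ ℤ.∣ coeff h (true ∷ S) ∣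
halves-bound h b S = subst (2 ℕ.* ℤ.∣ coeff (restrict b h) S ∣ ℕ.≤_) (sym halves) (bound b)
  where
  u = coeff (restrict false h) S
  v = coeff (restrict true h) S
  halves : ℤ.∣ coeff h (false ∷ S) ∣ ℕ.+ ℤ.∣ coeff h (true ∷ S) ∣ ≡ ℤ.∣ u ℤ.+ v ∣ ℕ.+ ℤ.∣ u ℤ.- v ∣
  halves = cong₂ ℕ._+_ (cong ℤ.∣_∣ (coeff-split-false h S)) (cong ℤ.∣_∣ (coeff-split-true h S))
  bound : ∀ b → 2 ℕ.* ℤ.∣ coeff (restrict b h) S ∣ ℕ.≤ ℤ.∣ u ℤ.+ v ∣ ℕ.+ ℤ.∣ u ℤ.- v ∣
  bound false = proj₁ (sum-difference-bound u v)
  bound true  = proj₂ (sum-difference-bound u v)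

spectralNorm-bound : ∀ n (h : Cube n → ℤ) x → 2 ℕ.^ n ℕ.* ℤ.∣ h x ∣ ℕ.≤ spectralNorm h
spectralNorm-bound zero h [] =
  ℕP.≤-reflexive (cong (λ t → ℤ.∣ t ∣ ℕ.+ 0) (sym (trans (ℤP.+-identityʳ _) (ℤP.*-identityʳ (h [])))))
spectralNorm-bound (suc n) h (b ∷ x) = begin
  2 ℕ.* 2 ℕ.^ n ℕ.* ℤ.∣ h (b ∷ x) ∣
    ≡⟨ ℕP.*-assoc 2 (2 ℕ.^ n) _ ⟩
  2 ℕ.* (2 ℕ.^ n ℕ.* ℤ.∣ restrict b h x ∣)
    ≤⟨ ℕP.*-monoʳ-≤ 2 (spectralNorm-bound n (restrict b h) x) ⟩
  2 ℕ.* spectralNorm (restrict b h)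
    ≡⟨ ∑-hom (2 ℕ.*_) refl (ℕP.*-distribˡ-+ 2) _ (allCube n) ⟩
  ∑ (λ S → 2 ℕ.* ℤ.∣ coeff (restrict b h) S ∣) (allCube n)
    ≤⟨ ∑-mono-≤ (halves-bound h b) (allCube n) ⟩
  ∑ (λ S → ℤ.∣ coeff h (false ∷ S) ∣ ℕ.+ ℤ.∣ coeff h (true ∷ S) ∣) (allCube n)
    ≡⟨ ∑-+ _ _ (allCube n) ⟩
  ∑ (λ S → ℤ.∣ coeff h (false ∷ S) ∣) (allCube n) ℕ.+ ∑ (λ S → ℤ.∣ coeff h (true ∷ S) ∣) (allCube n)
    ≡⟨ sym (∑-cube-split (λ S → ℤ.∣ coeff h S ∣)) ⟩
  spectralNorm h ∎
  where open ℕP.≤-Reasoning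

sign-gap : ∀ {a b : ℤ} → (a ≡ + 1 ⊎ a ≡ ℤ.- + 1) → (b ≡ + 1 ⊎ b ≡ ℤ.- + 1) →
           ¬ (a ≡ b) → ℤ.∣ a ℤ.- b ∣ ≡ 2
sign-gap (inj₁ refl) (inj₁ refl) a≢b = contradiction refl a≢b
sign-gap (inj₁ refl) (inj₂ refl) a≢b = refl
sign-gap (inj₂ refl) (inj₁ refl) a≢b = refl
sign-gap (inj₂ refl) (inj₂ refl) a≢b = contradiction refl a≢b

spectralWeight-bound : ∀ {n} (f : Cube n → ℤ) → IsSignValued f → ∀ i → DependsOn f i →
  2 ℕ.^ n ℕ.≤ spectralWeight i f
spectralWeight-bound {n} f ±1 i (x , fx≢fx⊕eᵢ) = ℕP.*-cancelˡ-≤ 2 (begin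
  2 ℕ.* 2 ℕ.^ n                          ≡⟨ ℕP.*-comm 2 (2 ℕ.^ n) ⟩
  2 ℕ.^ n ℕ.* 2                          ≡⟨ cong (2 ℕ.^ n ℕ.*_) (sym jump) ⟩
  2 ℕ.^ n ℕ.* ℤ.∣ derivative i f x ∣     ≤⟨ spectralNorm-bound n (derivative i f) x ⟩
  spectralNorm (derivative i f)          ≡⟨ spectralNorm-derivative f i ⟩
  2 ℕ.* spectralWeight i f               ∎)
  where
  open ℕP.≤-Reasoning
  jump : ℤ.∣ derivative i f x ∣ ≡ 2
  jump = sign-gap (±1 x) (±1 (flip x i)) fx≢fx⊕eᵢ

weighted-card : ∀ {n} c (S : Cube n) → c ℕ.* card S ≡ ∑[ i < n ] (if lookup S i then c else 0)
weighted-card c []          = ℕP.*-zeroʳ c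
weighted-card c (false ∷ S) = weighted-card c S
weighted-card c (true  ∷ S) = trans (ℕP.*-suc c (card S)) (cong (c ℕ.+_) (weighted-card c S))

weightedNorm : ∀ {n} → (Cube n → ℤ) → ℕ
weightedNorm {n} h = ∑ (λ S → ℤ.∣ coeff h S ∣ ℕ.* card S) (allCube n)

weightedNorm-by-coordinates : ∀ {n} (h : Cube n → ℤ) → weightedNorm h ≡ ∑[ i < n ] spectralWeight i h
weightedNorm-by-coordinates {n} h =
  trans (∑-cong (λ S → weighted-card ℤ.∣ coeff h S ∣ S) (allCube n)) (∑-swap {n = n} _ (allCube n))

weightedNorm-bound : ∀ n (f : Cube n → ℤ) → IsSignValued f → (∀ i → DependsOn f i) →
  n ℕ.* 2 ℕ.^ n ℕ.≤ weightedNorm f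
weightedNorm-bound n f ±1 dep =
  subst (n ℕ.* 2 ℕ.^ n ℕ.≤_) (sym (weightedNorm-by-coordinates f))
        (∑-lower-bound n (2 ℕ.^ n) _ (λ i → spectralWeight-bound f ±1 i (dep i)))

-- The denominator 2^n of the Fourier coefficients is nonzero.  The rational
-- bookkeeping below is done in ℚᵘ, where fractions need not be reduced.
2^n-nonZero : ∀ n → ℕ.NonZero (2 ℕ.^ n)
2^n-nonZero n = ℕ.>-nonZero (ℕP.m^n>0 2 n)

fraction-toℚᵘ : ∀ (c : ℤ) D .{{_ : ℕ.NonZero D}} → ℚ.toℚᵘ (c / D) ℚᵘ.≃ ℚᵘ.mkℚᵘ c (ℕ.pred D)
fraction-toℚᵘ c (suc d) = ℚP.toℚᵘ-fromℚᵘ (ℚᵘ.mkℚᵘ c d)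

term-toℚᵘ : ∀ (c : ℤ) (k : ℕ) D .{{_ : ℕ.NonZero D}} →
  ℚ.toℚᵘ (ℚ.∣ c / D ∣ ℚ.* (+ k / 1)) ℚᵘ.≃ ℚᵘ.mkℚᵘ (+ (ℤ.∣ c ∣ ℕ.* k)) (ℕ.pred D)
term-toℚᵘ c k D =
  ℚᵘP.≃-trans (ℚP.toℚᵘ-homo-* ℚ.∣ c / D ∣ (+ k / 1))
  (ℚᵘP.≃-trans (ℚᵘP.*-cong (ℚᵘP.≃-trans (ℚP.toℚᵘ-homo-∣-∣ (c / D)) (ℚᵘP.∣-∣-cong (fraction-toℚᵘ c D)))
                           (fraction-toℚᵘ (+ k) 1))
               (times-integer ℤ.∣ c ∣ k (ℕ.pred D)))
  where
  times-integer : ∀ a k d → ℚᵘ.mkℚᵘ (+ a) d ℚᵘ.* ℚᵘ.mkℚᵘ (+ k) 0 ℚᵘ.≃ ℚᵘ.mkℚᵘ (+ (a ℕ.* k)) d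
  times-integer a k d =
    ℚᵘ.*≡* (cong₂ ℤ._*_ (sym (ℤP.pos-* a k)) (cong (λ m → + suc m) (sym (ℕP.*-identityʳ d))))

sum-toℚᵘ : ∀ {A : Set} (g : A → ℚ) (a : A → ℕ) d →
  (∀ x → ℚ.toℚᵘ (g x) ℚᵘ.≃ ℚᵘ.mkℚᵘ (+ a x) d) →
  ∀ L → ℚ.toℚᵘ (sumℚ (map g L)) ℚᵘ.≃ ℚᵘ.mkℚᵘ (+ ∑ a L) d
sum-toℚᵘ g a d g≃a []      = ℚᵘ.*≡* refl
sum-toℚᵘ g a d g≃a (x ∷ L) =
  ℚᵘP.≃-trans (ℚP.toℚᵘ-homo-+ (g x) (sumℚ (map g L)))
  (ℚᵘP.≃-trans (ℚᵘP.+-cong (g≃a x) (sum-toℚᵘ g a d g≃a L)) (add-fractions (a x) (∑ a L)))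
  where
  add-fractions : ∀ m k → ℚᵘ.mkℚᵘ (+ m) d ℚᵘ.+ ℚᵘ.mkℚᵘ (+ k) d ℚᵘ.≃ ℚᵘ.mkℚᵘ (+ (m ℕ.+ k)) d
  add-fractions m k = ℚᵘ.*≡* (trans (ring (+ m) (+ k) (+ suc d))
    (sym (cong₂ ℤ._*_ (ℤP.pos-+ m k) (ℤP.pos-* (suc d) (suc d)))))
    where
    ring : ∀ M K D → (M ℤ.* D ℤ.+ K ℤ.* D) ℤ.* D ≡ (M ℤ.+ K) ℤ.* (D ℤ.* D)
    ring = ℤRing.solve-∀

weightedL1-as-fraction : ∀ {n} (f : Cube n → ℤ) →
  ℚ.toℚᵘ (weightedL1 f) ℚᵘ.≃ ℚᵘ.mkℚᵘ (+ weightedNorm f) (ℕ.pred (2 ℕ.^ n))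
weightedL1-as-fraction {n} f =
  sum-toℚᵘ _ _ _ (λ S → term-toℚᵘ (coeff f S) (card S) (2 ℕ.^ n) {{2^n-nonZero n}}) (allCube n)

fraction-≤ : ∀ {m k d} → m ℕ.* suc d ℕ.≤ k → ℚᵘ.mkℚᵘ (+ m) 0 ℚᵘ.≤ ℚᵘ.mkℚᵘ (+ k) d
fraction-≤ {m} {k} {d} m*D≤k = ℚᵘ.*≤* (subst₂ ℤ._≤_ (ℤP.pos-* m (suc d)) (ℤP.pos-* k 1)
  (ℤ.+≤+ (subst (m ℕ.* suc d ℕ.≤_) (sym (ℕP.*-identityʳ k)) m*D≤k)))

proposition12 : (n : ℕ) (f : Cube n → ℤ) → IsSignValued f →
    (∀ (i : Fin n) → DependsOn f i) →
    (+ n) / 1 ≤ weightedL1 f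
proposition12 n f ±1 dep =
  ℚP.toℚᵘ-cancel-≤ (ℚᵘP.≤-respˡ-≃ (ℚᵘP.≃-sym (fraction-toℚᵘ (+ n) 1))
                   (ℚᵘP.≤-respʳ-≃ (ℚᵘP.≃-sym (weightedL1-as-fraction f))
                   (fraction-≤ n*2^n≤T)))
  where
  n*2^n≤T : n ℕ.* suc (ℕ.pred (2 ℕ.^ n)) ℕ.≤ weightedNorm f
  n*2^n≤T = subst (λ D → n ℕ.* D ℕ.≤ weightedNorm f) (sym (ℕP.suc-pred (2 ℕ.^ n) {{2^n-nonZero n}}))
                  (weightedNorm-bound n f ±1 dep)
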